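{- Consider the class of finite binary relations quasi-ordered by $\mathbf{A}\preceq\mathbf{B}$ iff there exists a Tukey morphism $\mathbf{A}\to\mathbf{B}$, and write $\mathbf{A}\prec\mathbf{B}$ if $\mathbf{A}\preceq\mathbf{B}$ and not $\mathbf{B}\preceq\mathbf{A}$. Then: (i) there is an infinite sequence of finite binary relations $\mathbf{A}_1\prec\mathbf{A}_2\prec\mathbf{A}_3\prec\cdots$; (ii) there is an infinite sequence of finite binary relations $\mathbf{B}_1\succ\mathbf{B}_2\succ\mathbf{B}_3\succ\cdots$; (iii) there is an infinite sequence of finite binary relations $\mathbf{D}_1,\mathbf{D}_2,\ldots$ such that for all $i\neq j$, neither $\mathbf{D}_i\preceq\mathbf{D}_j$ nor $\mathbf{D}_j\preceq\mathbf{D}_i$.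
   Context: A binary relation is a triple $\mathbf{A}=(A_-,A_+,A)$ where $A_-,A_+$ are sets and $A\subseteq A_-\times A_+$; it is finite if $A_-$ and $A_+$ are finite. A (Tukey) morphism from $\mathbf{A}$ to $\mathbf{B}$ is a pair of functions $\phi_-\colon B_-\to A_-$, $\phi_+\colon A_+\to B_+$ such that for all $b\in B_-$ and $a\in A_+$, $\phi_-(b)\mathrel{A}a$ implies $b\mathrel{B}\phi_+(a)$; we write $\mathbf{A}\to\mathbf{B}$ if such a morphism exists. -}

module Defs where

open import Data.Nat using (ℕ)
open import Data.Fin using (Fin)
open import Data.Bool using (Bool; T)
open import Data.Product using (Σ; ∃; _×_)
open import Relation.Nullary using (¬_)

-- Finite carriers are represented (up to bijection) as Fin neg and Fin pos;
-- a subset of the finite set Fin neg × Fin pos is given by its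
-- characteristic function into Bool.
record FinRel : Set where
  constructor finRel
  field
    neg : ℕ
    pos : ℕ
    rel : Fin neg → Fin pos → Bool

open FinRel public

Holds : (R : FinRel) → Fin (neg R) → Fin (pos R) → Set
Holds R a b = T (rel R a b)

record TukeyMorphism (A B : FinRel) : Set where
  field
    φ₋ : Fin (neg B) → Fin (neg A)
    φ₊ : Fin (pos A) → Fin (pos B)
    preserves : ∀ (b : Fin (neg B)) (a : Fin (pos A)) →
                Holds A (φ₋ b) a → Holds B b (φ₊ a)

_⪯_ : FinRel → FinRel → Set
A ⪯ B = TukeyMorphism A B

_≺_ : FinRel → FinRel → Set
A ≺ B = A ⪯ B × ¬ (B ⪯ A)

-- A morphism
-- Ieq m → Ieq n makes φ₋ injective and one Ineq n → Ineq m makes φ₊ injective,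
-- so n ↦ Ieq n descends strictly and n ↦ Ineq n ascends strictly.  For the
-- antichain, D i is "the point b is an entry of the (i+1)-tuple c" on
-- (i+2)(i+1) points.  If i < j, cutting the points of D i into i+2 blocks of
-- size i+1 and pushing the blocks forward covers the (j+2)(j+1) points of D j
-- by i+2 tuples of length j+1, which is too few.  If j < i, any j+2 points of
-- D j pull back into a single (i+1)-tuple of D i, whose image is a
-- (j+1)-tuple containing all of them, which is impossible.
module Submission where

open import Defs
open import Data.Bool using (true; false; not; T)
open import Data.Bool.Properties using (not-involutive)
open import Data.Empty using (⊥-elim)
open import Data.Fin using (Fin; toℕ; fromℕ<; inject≤; combine; remQuot; quotient; remainder; finToFun; funToFin)
open import Data.Fin.Properties using (_≟_; any?; injective⇒≤; toℕ-injective; toℕ-fromℕ<; toℕ-inject≤; toℕ<n; remQuot-combine; combine-remQuot; finToFun-funToFin)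
open import Data.Nat using (ℕ; suc; _*_; _^_; _⊓_; _≤_; _<_; s≤s; s≤s⁻¹)
open import Data.Nat.Properties using (n≤1+n; 1+n≰n; <⇒≱; *-cancelʳ-≤; m≤m*n; m⊓n≤n; m≤n⇒m⊓n≡m; <-cmp)
open import Data.Product using (Σ; ∃; _×_; _,_; proj₁; proj₂; uncurry)
open import Function using (_∘_; id)
open import Function.Definitions using (StrictlyInverseʳ)
open import Function.Consequences.Propositional using (inverseʳ⇒injective; strictlyInverseʳ⇒inverseʳ)
open import Relation.Binary using (tri<; tri≈; tri>)
open import Relation.Binary.PropositionalEquality using (_≡_; refl; sym; trans; cong; subst)
open import Relation.Nullary using (¬_)
open import Relation.Nullary.Decidable using (isYes; toWitness; fromWitness)

private
  variable
    A B C : FinRel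
    k l m n q : ℕ

leftInverse⇒≤ : (f : Fin m → Fin n) {g : Fin n → Fin m} → StrictlyInverseʳ _≡_ f g → m ≤ n
leftInverse⇒≤ f {g} gf = injective⇒≤ (inverseʳ⇒injective f (strictlyInverseʳ⇒inverseʳ {f⁻¹ = g} f gf))

clamp : Fin m → Fin (suc n)
clamp {n = n} i = fromℕ< (s≤s (m⊓n≤n (toℕ i) n))

clamp-inject≤ : (i : Fin (suc n)) (le : suc n ≤ m) → clamp (inject≤ i le) ≡ i
clamp-inject≤ {n} i le = toℕ-injective (trans (toℕ-fromℕ< _)
  (trans (cong (_⊓ n) (toℕ-inject≤ i le)) (m≤n⇒m⊓n≡m (s≤s⁻¹ (toℕ<n i)))))

⪯-trans : A ⪯ B → B ⪯ C → A ⪯ C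
⪯-trans M N = record
  { φ₋ = M.φ₋ ∘ N.φ₋
  ; φ₊ = N.φ₊ ∘ M.φ₊
  ; preserves = λ c a → N.preserves c (M.φ₊ a) ∘ M.preserves (N.φ₋ c) a
  }
  where
  module M = TukeyMorphism M
  module N = TukeyMorphism N

T-not⇒¬T : ∀ x → T (not x) → ¬ T x
T-not⇒¬T false _ ()

¬T⇒T-not : ∀ x → ¬ T x → T (not x)
¬T⇒T-not false _ = _
¬T⇒T-not true ¬t = ¬t _

dual : FinRel → FinRel
dual R = finRel (pos R) (neg R) (λ a b → not (rel R b a))

dual-⪯ : A ⪯ B → dual B ⪯ dual A
dual-⪯ {A} {B} M = record
  { φ₋ = φ₊
  ; φ₊ = φ₋
  ; preserves = λ a b h →
      ¬T⇒T-not (rel A (φ₋ b) a) (T-not⇒¬T (rel B b (φ₊ a)) h ∘ preserves b a)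
  }
  where open TukeyMorphism M

⪯-dual-dual : A ⪯ dual (dual A)
⪯-dual-dual {A} = record
  { φ₋ = id ; φ₊ = id ; preserves = λ b a → subst T (sym (not-involutive (rel A b a))) }

dual-dual-⪯ : dual (dual A) ⪯ A
dual-dual-⪯ {A} = record
  { φ₋ = id ; φ₊ = id ; preserves = λ b a → subst T (not-involutive (rel A b a)) }

Ieq : ℕ → FinRel
Ieq n = finRel n n (λ b a → isYes (b ≟ a))

Ineq : ℕ → FinRel
Ineq = dual ∘ Ieq

Ieq-⪯ : suc n ≤ m → Ieq m ⪯ Ieq (suc n)
Ieq-⪯ le = record
  { φ₋ = λ b → inject≤ b le
  ; φ₊ = clamp
  ; preserves = λ b a h → fromWitness (trans (sym (clamp-inject≤ b le)) (cong clamp (toWitness h)))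
  }

Ieq-⪯⇒≤ : Ieq m ⪯ Ieq n → n ≤ m
Ieq-⪯⇒≤ M = leftInverse⇒≤ φ₋ {φ₊}
  (λ b → sym (toWitness (preserves b (φ₋ b) (fromWitness refl))))
  where open TukeyMorphism M

Ineq-⪯ : suc n ≤ m → Ineq (suc n) ⪯ Ineq m
Ineq-⪯ = dual-⪯ ∘ Ieq-⪯

Ineq-⪯⇒≤ : Ineq n ⪯ Ineq m → n ≤ m
Ineq-⪯⇒≤ M = Ieq-⪯⇒≤ (⪯-trans ⪯-dual-dual (⪯-trans (dual-⪯ M) dual-dual-⪯))

-- b is an entry of the k-tuple c, tuples Fin k → Fin n being coded in Fin (n ^ k).
Member : ℕ → ℕ → FinRel
Member n k = finRel n (n ^ k) (λ b c → isYes (any? (λ y → finToFun {n} {k} c y ≟ b)))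

∈-intro : (t : Fin k → Fin n) (y : Fin k) {b : Fin n} → t y ≡ b → Holds (Member n k) b (funToFin t)
∈-intro t y e = fromWitness (y , trans (finToFun-funToFin t y) e)

∈-elim : ∀ n k {b : Fin n} (c : Fin (n ^ k)) → Holds (Member n k) b c → ∃ λ y → finToFun {n} {k} c y ≡ b
∈-elim _ _ _ = toWitness

block : ∀ q k → Fin q → Fin ((q * k) ^ k)
block q k s = funToFin (combine {q} {k} s)

∈-block : ∀ q k (b : Fin (q * k)) → Holds (Member (q * k) k) b (block q k (quotient k b))
∈-block q k b = ∈-intro (combine (quotient {q} k b)) (remainder {q} k b) (combine-remQuot {q} k b)

Member-⪯⇒≤ : ∀ q k → Member (q * k) k ⪯ Member m l → m ≤ q * l
Member-⪯⇒≤ {m} {l} q k M = leftInverse⇒≤ index {point} point∘index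
  where
  open TukeyMorphism M
  cover : Fin q → Fin (m ^ l)
  cover = φ₊ ∘ block q k
  blockOf : Fin m → Fin q
  blockOf b = quotient k (φ₋ b)
  covered : ∀ b → ∃ λ y → finToFun {m} {l} (cover (blockOf b)) y ≡ b
  covered b = ∈-elim m l (cover (blockOf b))
    (preserves b (block q k (blockOf b)) (∈-block q k (φ₋ b)))
  index : Fin m → Fin (q * l)
  index b = combine (blockOf b) (proj₁ (covered b))
  point : Fin (q * l) → Fin m
  point = uncurry (finToFun {m} {l} ∘ cover) ∘ remQuot l
  point∘index : ∀ b → point (index b) ≡ b
  point∘index b = trans (cong (uncurry (finToFun {m} {l} ∘ cover)) (remQuot-combine {q} {l} _ _))
                        (proj₂ (covered b))

Member-⋠ : suc l ≤ k → suc l ≤ m → ¬ (Member n k ⪯ Member m l)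
Member-⋠ {l} {k} {m} {n} l<k l<m M = 1+n≰n (leftInverse⇒≤ index {point} point∘index)
  where
  open TukeyMorphism M
  embed : Fin (suc l) → Fin m
  embed x = inject≤ x l<m
  tuple : Fin k → Fin n
  tuple = φ₋ ∘ embed ∘ clamp
  image : Fin (m ^ l)
  image = φ₊ (funToFin tuple)
  covered : ∀ x → ∃ λ y → finToFun {m} {l} image y ≡ embed x
  covered x = ∈-elim m l image (preserves (embed x) (funToFin tuple)
    (∈-intro tuple (inject≤ x l<k) (cong (φ₋ ∘ embed) (clamp-inject≤ x l<k))))
  index : Fin (suc l) → Fin l
  index x = proj₁ (covered x)
  point : Fin l → Fin (suc l)
  point = clamp ∘ finToFun {m} {l} image
  point∘index : ∀ x → point (index x) ≡ x
  point∘index x = trans (cong clamp (proj₂ (covered x))) (clamp-inject≤ x l<m)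

D : ℕ → FinRel
D i = Member (suc (suc i) * suc i) (suc i)

D-⋠-later : ∀ {i j} → i < j → ¬ (D i ⪯ D j)
D-⋠-later {i} {j} i<j M =
  <⇒≱ (s≤s (s≤s i<j))
      (*-cancelʳ-≤ (suc (suc j)) (suc (suc i)) (suc j) (Member-⪯⇒≤ (suc (suc i)) (suc i) M))

D-⋠-earlier : ∀ {i j} → i < j → ¬ (D j ⪯ D i)
D-⋠-earlier {i} i<j = Member-⋠ {l = suc i} (s≤s i<j) (m≤m*n (suc (suc i)) (suc i))

D-incomparable : ∀ i j → ¬ (i ≡ j) → ¬ (D i ⪯ D j) × ¬ (D j ⪯ D i)
D-incomparable i j i≢j with <-cmp i j
... | tri< i<j _ _ = D-⋠-later i<j , D-⋠-earlier i<j
... | tri≈ _ i≡j _ = ⊥-elim (i≢j i≡j)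
... | tri> _ _ j<i = D-⋠-earlier j<i , D-⋠-later j<i

corollary6p6 : (Σ (ℕ → FinRel) λ A → ∀ (i : ℕ) → A i ≺ A (suc i))
    × (Σ (ℕ → FinRel) λ B → ∀ (i : ℕ) → B (suc i) ≺ B i)
    × (Σ (ℕ → FinRel) λ D → ∀ (i j : ℕ) → ¬ (i ≡ j) → ¬ (D i ⪯ D j) × ¬ (D j ⪯ D i))
corollary6p6 =
  (Ineq ∘ suc , λ i → Ineq-⪯ (n≤1+n _) , 1+n≰n ∘ Ineq-⪯⇒≤) ,
  (Ieq ∘ suc , λ i → Ieq-⪯ (n≤1+n _) , 1+n≰n ∘ Ieq-⪯⇒≤) ,
  (D , D-incomparable)
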